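{- Let $k$ be a positive even integer and let $G$ be a nearly $k$-edge-connected graph. Suppose there exists $X\subset V(G)$ with $d(X)=k$ such that every vertex $x\in X$ has degree $k+1$. Then there exists an edge $e$ with both ends in $X$ such that $G\setminus e$ is again (nearly) $k$-edge-connected: if $G$ is $k$-edge-connected then $G\setminus e$ is $k$-edge-connected, and if $G$ is nearly $k$-edge-connected with special vertex $u$ then $G\setminus e$ is nearly $k$-edge-connected with special vertex $u$.
   Context: Graphs are finite, undirected, may have loops and parallel edges. For $X\subseteq V(G)$, $\delta(X)$ is the set of edges with exactly one end in $X$, $d(X)=|\delta(X)|$, and $X^c=V(G)\setminus X$. $G$ is $k$-edge-connected if $d(X)\ge k$ for all $\emptyset\ne X\subsetneq V(G)$. $G$ is nearly $k$-edge-connected if either $G$ is $k$-edge-connected, or there is a single vertex $u$ (the special vertex) of even degree less than $k$ such that every edge-cut of $G$ other than $\delta(\{u\})$ has size at least $k$. -}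

module Defs where

open import Data.Nat using (ℕ; zero; suc; _+_; _≤_; _<_; _≥_)
open import Data.Nat.Properties using ()
open import Data.Bool using (Bool; true; false; T; not; _xor_)
open import Data.Fin using (Fin; punchIn)
open import Data.Fin.Properties using ()
open import Data.Product using (_×_; _,_; proj₁; proj₂; ∃)
open import Data.List using (List; filter; length; allFin)
open import Data.Vec.Functional using ()
open import Relation.Nullary using (¬_)
open import Relation.Nullary.Decidable using (⌊_⌋)
open import Relation.Binary.PropositionalEquality using (_≡_)
open import Data.Fin using (_≟_)

-- A finite multigraph (loops and parallel edges allowed) with vertex set
-- Fin n and edge set Fin m; each edge has an (unordered) pair of ends.
record Graph : Set where
  field
    n   : ℕ
    m   : ℕ
    ends : Fin m → Fin n × Fin n

open Graph public

VSet : Graph → Set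
VSet G = Fin (n G) → Bool

count : ∀ {k} → (Fin k → Bool) → ℕ
count {k} p = length (filter (λ i → T? (p i)) (allFin k))
  where
  open import Relation.Unary using (Pred)
  open import Data.Bool.Properties using (T?)

crosses : (G : Graph) → VSet G → Fin (m G) → Bool
crosses G X e = X (proj₁ (ends G e)) xor X (proj₂ (ends G e))

d : (G : Graph) → VSet G → ℕ
d G X = count (crosses G X)

-- degree of a vertex; a loop contributes 2
isEnd₁ isEnd₂ : (G : Graph) → Fin (n G) → Fin (m G) → Bool
isEnd₁ G v e = ⌊ proj₁ (ends G e) ≟ v ⌋
isEnd₂ G v e = ⌊ proj₂ (ends G e) ≟ v ⌋

deg : (G : Graph) → Fin (n G) → ℕ
deg G v = count (isEnd₁ G v) + count (isEnd₂ G v)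

single : (G : Graph) → Fin (n G) → VSet G
single G u v = ⌊ v ≟ u ⌋

compl : (G : Graph) → VSet G → VSet G
compl G X v = not (X v)

Nonempty Proper : (G : Graph) → VSet G → Set
Nonempty G X = ∃ λ v → X v ≡ true
Proper G X = ∃ λ v → X v ≡ false

EdgeConn : ℕ → Graph → Set
EdgeConn k G = (X : VSet G) → Nonempty G X → Proper G X → d G X ≥ k

data Even : ℕ → Set where
  even0  : Even zero
  evenSS : ∀ {j} → Even j → Even (suc (suc j))

_≐_ : ∀ {G : Graph} → VSet G → VSet G → Set
X ≐ Y = ∀ v → X v ≡ Y v

NearlyWith : ℕ → (G : Graph) → Fin (n G) → Set
NearlyWith k G u =
  Even (deg G u) × deg G u < k ×
  ((X : VSet G) → Nonempty G X → Proper G X →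
     ¬ (_≐_ {G} X (single G u)) → ¬ (_≐_ {G} X (compl G (single G u))) →
     d G X ≥ k)

NearlyEdgeConn : ℕ → Graph → Set
NearlyEdgeConn k G = EdgeConn k G ⊎' ∃ λ u → NearlyWith k G u
  where open import Data.Sum using () renaming (_⊎_ to _⊎'_)

-- deleting edge e from G (G \ e): the remaining edges are reindexed
-- by punchIn e, which enumerates Fin (suc m') ∖ {e} in order.
delEnds : ∀ {nv m'} → (Fin (suc m') → Fin nv × Fin nv) → Fin (suc m') →
          Fin m' → Fin nv × Fin nv
delEnds f e i = f (punchIn e i)

delEdges : (G : Graph) → Fin (m G) → ℕ
delEdges record { m = suc m' } e = m'

delEndsG : (G : Graph) → (e : Fin (m G)) → Fin (delEdges G e) → Fin (n G) × Fin (n G)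
delEndsG record { n = nv ; m = suc m' ; ends = f } e = delEnds f e

delete : (G : Graph) → Fin (m G) → Graph
delete G e = record { n = n G ; m = delEdges G e ; ends = delEndsG G e }

module Submission where

-- Call a vertex set Z tight if d(Z) = k.  Take a minimal tight set Z ⊆ X
-- (X itself is tight).  Its vertices have degree k+1 > d(Z), so some edge
-- e has both ends in Z.  Were e crossed by a tight set W, uncrossing W
-- with Z would give a smaller tight subset of Z: W itself, V ∖ W, Z ∖ W
-- (posimodularity) or Z ∩ W (submodularity).  Cuts of size below k exist
-- only at a special vertex u ∉ X, and the case split ensures that the
-- sets compared with k are never {u} or V ∖ {u}.  So no tight set crosses
-- e, hence deleting e keeps every cut of size ≥ k, and it leaves the
-- degree of u alone.

open import Defs
open import Data.Nat using (ℕ; zero; suc; _+_; _≤_; _<_; z≤n; s≤s; s≤s⁻¹; _≤?_; _≟_)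
open import Data.Nat.Properties
  using (≤-refl; ≤-trans; ≤-reflexive; ≤-antisym; <-≤-trans; ≤∧≢⇒<; +-mono-≤;
         +-mono-<-≤; +-mono-≤-<; +-monoʳ-≤; +-cancelʳ-≤; +-identityʳ; 1+n≰n; <⇒≤; <-irrefl;
         +-0-commutativeMonoid)
open import Data.Nat.Induction using (<-wellFounded)
open import Data.Bool using (Bool; true; false; _∧_; _∨_; not; _xor_)
open import Data.Bool.Properties using (T?; not-involutive; not-distribˡ-xor; not-distribʳ-xor; ∧-conicalˡ; ∧-zeroʳ; ∨-zeroʳ; ¬-not)
  renaming (_≟_ to _≟ᵇ_)
open import Data.Fin using (Fin; zero; suc; punchIn) renaming (_≟_ to _≟ᶠ_)
open import Data.Fin.Properties using (any?)
open import Data.Fin.Subset.Properties using (anySubset?)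
open import Data.Vec using (lookup; tabulate)
open import Data.Vec.Properties using (lookup∘tabulate)
import Data.List as List
open import Data.List using (filter; length)
open import Data.Product using (_×_; _,_; Σ; ∃; proj₁; proj₂)
open import Data.Sum using (_⊎_; inj₁; inj₂)
open import Data.Empty using (⊥-elim)
open import Relation.Nullary using (¬_; Dec; yes; no)
open import Relation.Nullary.Decidable using (⌊_⌋; True; toWitness; _×-dec_)
open import Induction.WellFounded using (Acc; acc)
open import Relation.Binary.PropositionalEquality
  using (_≡_; _≢_; _≗_; refl; sym; trans; cong; cong₂; subst; subst₂)
open import Algebra.Properties.CommutativeMonoid.Sum +-0-commutativeMonoid
  using (sum; sum-cong-≗; sum-replicate-zero; sum-remove; ∑-distrib-+)

⟦_⟧ : Bool → ℕ
⟦ true ⟧ = 1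
⟦ false ⟧ = 0

decide : ∀ {a b} {checked : True (a ≤? b)} → a ≤ b
decide {checked = checked} = toWitness checked

sum-mono-≤ : ∀ {k} {f g : Fin k → ℕ} → (∀ i → f i ≤ g i) → sum f ≤ sum g
sum-mono-≤ {zero} f≤g = z≤n
sum-mono-≤ {suc k} f≤g = +-mono-≤ (f≤g zero) (sum-mono-≤ (λ i → f≤g (suc i)))

sum-mono-< : ∀ {k} {f g : Fin k → ℕ} → (∀ i → f i ≤ g i) → (j : Fin k) → f j < g j → sum f < sum g
sum-mono-< {suc k} f≤g zero fj<gj = +-mono-<-≤ fj<gj (sum-mono-≤ (λ i → f≤g (suc i)))
sum-mono-< {suc k} f≤g (suc j) fj<gj = +-mono-≤-< (f≤g zero) (sum-mono-< (λ i → f≤g (suc i)) j fj<gj)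

count-sum : ∀ {k} (p : Fin k → Bool) → count p ≡ sum (λ i → ⟦ p i ⟧)
count-sum {k} p = filter-tabulate (λ i → i)
  where
  filter-tabulate : ∀ {j} (g : Fin j → Fin k) →
    length (filter (λ i → T? (p i)) (List.tabulate g)) ≡ sum (λ i → ⟦ p (g i) ⟧)
  filter-tabulate {zero} g = refl
  filter-tabulate {suc j} g with p (g zero)
  ... | true = cong suc (filter-tabulate (λ i → g (suc i)))
  ... | false = filter-tabulate (λ i → g (suc i))

count-cong : ∀ {k} {p q : Fin k → Bool} → p ≗ q → count p ≡ count q
count-cong {p = p} {q} p≗q =
  trans (count-sum p) (trans (sum-cong-≗ (λ i → cong ⟦_⟧ (p≗q i))) (sym (count-sum q)))

count-none : ∀ {k} {p : Fin k → Bool} → (∀ i → p i ≡ false) → count p ≡ 0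
count-none {k} {p} none =
  trans (count-sum p) (trans (sum-cong-≗ (λ i → cong ⟦_⟧ (none i))) (sum-replicate-zero k))

count-remove : ∀ {k} (p : Fin (suc k) → Bool) (e : Fin (suc k)) →
  count p ≡ ⟦ p e ⟧ + count (λ i → p (punchIn e i))
count-remove p e = trans (count-sum p) (trans (sum-remove {i = e} (λ i → ⟦ p i ⟧))
  (cong (⟦ p e ⟧ +_) (sym (count-sum (λ i → p (punchIn e i))))))

count-+-mono : ∀ {k} (p q r s : Fin k → Bool) →
  (∀ i → ⟦ p i ⟧ + ⟦ q i ⟧ ≤ ⟦ r i ⟧ + ⟦ s i ⟧) → count p + count q ≤ count r + count s
count-+-mono p q r s pointwise = begin
  count p + count q                       ≡⟨ cong₂ _+_ (count-sum p) (count-sum q) ⟩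
  sum ⟦p⟧ + sum ⟦q⟧                       ≡⟨ sym (∑-distrib-+ ⟦p⟧ ⟦q⟧) ⟩
  sum (λ i → ⟦ p i ⟧ + ⟦ q i ⟧)           ≤⟨ sum-mono-≤ pointwise ⟩
  sum (λ i → ⟦ r i ⟧ + ⟦ s i ⟧)           ≡⟨ ∑-distrib-+ ⟦r⟧ ⟦s⟧ ⟩
  sum ⟦r⟧ + sum ⟦s⟧                       ≡⟨ sym (cong₂ _+_ (count-sum r) (count-sum s)) ⟩
  count r + count s                       ∎
  where
  open Data.Nat.Properties.≤-Reasoning
  ⟦p⟧ ⟦q⟧ ⟦r⟧ ⟦s⟧ : Fin _ → ℕ
  ⟦p⟧ i = ⟦ p i ⟧
  ⟦q⟧ i = ⟦ q i ⟧
  ⟦r⟧ i = ⟦ r i ⟧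
  ⟦s⟧ i = ⟦ s i ⟧

_⊆_ : ∀ {n} → (Fin n → Bool) → (Fin n → Bool) → Set
A ⊆ B = ∀ v → A v ≡ true → B v ≡ true

⊆-∉ : ∀ {n} {A B : Fin n → Bool} {v : Fin n} → A ⊆ B → B v ≡ false → A v ≡ false
⊆-∉ {A = A} {v = v} A⊆B Bv with A v in Av
... | true = trans (sym (A⊆B v Av)) Bv
... | false = refl

count-⊂ : ∀ {k} {A B : Fin k → Bool} → A ⊆ B → (j : Fin k) → A j ≡ false → B j ≡ true →
  count A < count B
count-⊂ {A = A} {B} A⊆B j Aj Bj = subst₂ _<_ (sym (count-sum A)) (sym (count-sum B))
  (sum-mono-< pointwise j (subst₂ (λ a b → ⟦ a ⟧ < ⟦ b ⟧) (sym Aj) (sym Bj) (s≤s z≤n)))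
  where
  pointwise : ∀ i → ⟦ A i ⟧ ≤ ⟦ B i ⟧
  pointwise i with A i in Ai
  ... | false = z≤n
  ... | true rewrite A⊆B i Ai = ≤-refl

⊆-or-escape : ∀ {n} (A B : Fin n → Bool) → A ⊆ B ⊎ ∃ λ v → A v ≡ true × B v ≡ false
⊆-or-escape A B with any? (λ v → (A v ≟ᵇ true) ×-dec (B v ≟ᵇ false))
... | yes escape = inj₂ escape
... | no noEscape = inj₁ included
  where
  included : A ⊆ B
  included v Av with B v in Bv
  ... | true = refl
  ... | false = ⊥-elim (noEscape (v , Av , Bv))

_∩_ _∪_ _∖_ : ∀ {n} → (Fin n → Bool) → (Fin n → Bool) → (Fin n → Bool)
(A ∩ B) v = A v ∧ B v
(A ∪ B) v = A v ∨ B v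
(A ∖ B) v = A v ∧ not (B v)

∁ : ∀ {n} → (Fin n → Bool) → (Fin n → Bool)
∁ A v = not (A v)

-- Membership in the Boolean combinations, computed from the operands
-- (the sets are explicit: they cannot be inferred from their values).
module _ {n} (A B : Fin n → Bool) {v : Fin n} where

  ∈∩ : A v ≡ true → B v ≡ true → (A ∩ B) v ≡ true
  ∈∩ Av Bv rewrite Av | Bv = refl

  ∉∩ʳ : B v ≡ false → (A ∩ B) v ≡ false
  ∉∩ʳ Bv rewrite Bv = ∧-zeroʳ (A v)

  ∈∪ˡ : A v ≡ true → (A ∪ B) v ≡ true
  ∈∪ˡ Av rewrite Av = refl

  ∈∪ʳ : B v ≡ true → (A ∪ B) v ≡ true
  ∈∪ʳ Bv rewrite Bv = ∨-zeroʳ (A v)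

  ∉∪ : A v ≡ false → B v ≡ false → (A ∪ B) v ≡ false
  ∉∪ Av Bv rewrite Av | Bv = refl

  ∈∖ : A v ≡ true → B v ≡ false → (A ∖ B) v ≡ true
  ∈∖ Av Bv rewrite Av | Bv = refl

  ∉∖ˡ : A v ≡ false → (A ∖ B) v ≡ false
  ∉∖ˡ Av rewrite Av = refl

  ∉∖ʳ : B v ≡ true → (A ∖ B) v ≡ false
  ∉∖ʳ Bv rewrite Bv = ∧-zeroʳ (A v)

∩-⊆ˡ : ∀ {n} (A B : Fin n → Bool) → (A ∩ B) ⊆ A
∩-⊆ˡ A B v = ∧-conicalˡ (A v) (B v)

not-true : ∀ {b} → not b ≡ true → b ≡ false
not-true {b} nb = trans (sym (not-involutive b)) (cong not nb)

xor-true : ∀ a b → a xor b ≡ true → (a ≡ true × b ≡ false) ⊎ (a ≡ false × b ≡ true)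
xor-true true false _ = inj₁ (refl , refl)
xor-true false true _ = inj₂ (refl , refl)

true≢false : true ≢ false
true≢false ()

-- Pointwise form of submodularity: an edge crossing A ∩ B or A ∪ B
-- crosses A or B, and one crossing both crosses A and B.
crossing-submodular : ∀ a₁ a₂ b₁ b₂ →
  ⟦ (a₁ ∧ b₁) xor (a₂ ∧ b₂) ⟧ + ⟦ (a₁ ∨ b₁) xor (a₂ ∨ b₂) ⟧ ≤ ⟦ a₁ xor a₂ ⟧ + ⟦ b₁ xor b₂ ⟧
crossing-submodular true  true  true  true  = decide
crossing-submodular true  true  true  false = decide
crossing-submodular true  true  false true  = decide
crossing-submodular true  true  false false = decide
crossing-submodular true  false true  true  = decide
crossing-submodular true  false true  false = decide
crossing-submodular true  false false true  = decide
crossing-submodular true  false false false = decide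
crossing-submodular false true  true  true  = decide
crossing-submodular false true  true  false = decide
crossing-submodular false true  false true  = decide
crossing-submodular false true  false false = decide
crossing-submodular false false true  true  = decide
crossing-submodular false false true  false = decide
crossing-submodular false false false true  = decide
crossing-submodular false false false false = decide

module _ (G : Graph) where

  Inside : VSet G → Fin (m G) → Set
  Inside A e = A (proj₁ (ends G e)) ≡ true × A (proj₂ (ends G e)) ≡ true

  d-cong : {A B : VSet G} → A ≗ B → d G A ≡ d G B
  d-cong A≗B = count-cong (λ e → cong₂ _xor_ (A≗B (proj₁ (ends G e))) (A≗B (proj₂ (ends G e))))

  d-∁ : (A : VSet G) → d G (∁ A) ≡ d G A
  d-∁ A = count-cong (λ e → not-xor-not (A (proj₁ (ends G e))) (A (proj₂ (ends G e))))
    where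
    not-xor-not : ∀ a b → not a xor not b ≡ a xor b
    not-xor-not a b = trans (sym (not-distribˡ-xor a (not b)))
      (trans (cong not (sym (not-distribʳ-xor a b))) (not-involutive (a xor b)))

  submodular : (A B : VSet G) → d G (A ∩ B) + d G (A ∪ B) ≤ d G A + d G B
  submodular A B = count-+-mono _ _ _ _ (λ e →
    crossing-submodular (A (proj₁ (ends G e))) (A (proj₂ (ends G e)))
                        (B (proj₁ (ends G e))) (B (proj₂ (ends G e))))

  -- Posimodularity, from submodularity applied to A and V ∖ B.
  posimodular : (A B : VSet G) → d G (A ∖ B) + d G (B ∖ A) ≤ d G A + d G B
  posimodular A B = begin
    d G (A ∖ B) + d G (B ∖ A)       ≡⟨ cong (d G (A ∖ B) +_) (sym (trans (d-cong deMorgan) (d-∁ (B ∖ A)))) ⟩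
    d G (A ∩ ∁ B) + d G (A ∪ ∁ B)   ≤⟨ submodular A (∁ B) ⟩
    d G A + d G (∁ B)               ≡⟨ cong (d G A +_) (d-∁ B) ⟩
    d G A + d G B                   ∎
    where
    open Data.Nat.Properties.≤-Reasoning
    deMorgan : (A ∪ ∁ B) ≗ ∁ (B ∖ A)
    deMorgan v with A v | B v
    ... | true  | true  = refl
    ... | true  | false = refl
    ... | false | true  = refl
    ... | false | false = refl

  positive-cut-nonempty : (A : VSet G) → 1 ≤ d G A → Nonempty G A
  positive-cut-nonempty A d≥1 with any? (λ v → A v ≟ᵇ true)
  ... | yes inA = inA
  ... | no noneInA = ⊥-elim (1+n≰n (subst (1 ≤_) (count-none crossesNot) d≥1))
    where
    empty : ∀ v → A v ≡ false
    empty v with A v in Av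
    ... | true = ⊥-elim (noneInA (v , Av))
    ... | false = refl
    crossesNot : ∀ e → crosses G A e ≡ false
    crossesNot e rewrite empty (proj₁ (ends G e)) | empty (proj₂ (ends G e)) = refl

  -- Applied to V ∖ A, which has the same cut.
  positive-cut-proper : (A : VSet G) → 1 ≤ d G A → Proper G A
  positive-cut-proper A d≥1 with positive-cut-nonempty (∁ A) (subst (1 ≤_) (sym (d-∁ A)) d≥1)
  ... | v , notAv = v , not-true notAv

  -- If no edge lies inside A, every edge at a vertex x of A crosses δ(A),
  -- so deg(x) ≤ d(A).
  deg≤cut : (A : VSet G) (x : Fin (n G)) → A x ≡ true → (∀ e → ¬ Inside A e) → deg G x ≤ d G A
  deg≤cut A x Ax noneInside = begin
    deg G x                                  ≤⟨ count-+-mono _ _ _ (λ _ → false)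
                                                  (λ e → end-crosses (ends G e) (noneInside e)) ⟩
    d G A + count {m G} (λ _ → false)        ≡⟨ cong (d G A +_) (count-none {m G} (λ _ → refl)) ⟩
    d G A + 0                                ≡⟨ +-identityʳ (d G A) ⟩
    d G A                                    ∎
    where
    open Data.Nat.Properties.≤-Reasoning
    end-crosses : (ab : Fin (n G) × Fin (n G)) → ¬ (A (proj₁ ab) ≡ true × A (proj₂ ab) ≡ true) →
      ⟦ ⌊ proj₁ ab ≟ᶠ x ⌋ ⟧ + ⟦ ⌊ proj₂ ab ≟ᶠ x ⌋ ⟧ ≤ ⟦ A (proj₁ ab) xor A (proj₂ ab) ⟧ + 0
    end-crosses (a , b) notInside with a ≟ᶠ x | b ≟ᶠ x
    ... | yes refl | yes refl = ⊥-elim (notInside (Ax , Ax))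
    ... | yes refl | no _ with A b in Ab
    ...   | true = ⊥-elim (notInside (Ax , refl))
    ...   | false rewrite Ax = ≤-refl
    end-crosses (a , b) notInside | no _ | yes refl with A a in Aa
    ...   | true = ⊥-elim (notInside (refl , Ax))
    ...   | false rewrite Ax = ≤-refl
    end-crosses (a , b) notInside | no _ | no _ = z≤n


≟-false : ∀ {k} {v u : Fin k} → v ≢ u → ⌊ v ≟ᶠ u ⌋ ≡ false
≟-false {v = v} {u} v≢u with v ≟ᶠ u
... | yes v≡u = ⊥-elim (v≢u v≡u)
... | no _ = refl

≟-refl : ∀ {k} (u : Fin k) → ⌊ u ≟ᶠ u ⌋ ≡ true
≟-refl u with u ≟ᶠ u
... | yes _ = refl
... | no u≢u = ⊥-elim (u≢u refl)

d-delete : (G : Graph) (e : Fin (m G)) (W : VSet G) →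
  d G W ≡ ⟦ crosses G W e ⟧ + d (delete G e) W
d-delete G@record { m = suc _ } e W = count-remove (crosses G W) e

deg-delete : (G : Graph) (e : Fin (m G)) (u : Fin (n G)) →
  proj₁ (ends G e) ≢ u → proj₂ (ends G e) ≢ u → deg (delete G e) u ≡ deg G u
deg-delete G@record { m = suc _ } e u end₁≢u end₂≢u =
  sym (cong₂ _+_ (unchanged (isEnd₁ G u) (≟-false end₁≢u)) (unchanged (isEnd₂ G u) (≟-false end₂≢u)))
  where
  unchanged : (p : Fin (m G) → Bool) → p e ≡ false → count p ≡ count (λ i → p (punchIn e i))
  unchanged p pe = trans (count-remove p e) (cong (λ b → ⟦ b ⟧ + count (λ i → p (punchIn e i))) pe)

TightCrossing : ℕ → (G : Graph) → Fin (m G) → Set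
TightCrossing k G e = ∃ λ (W : VSet G) → d G W ≡ k × crosses G W e ≡ true

cut-survives-delete : ∀ {k} (G : Graph) (e : Fin (m G)) → ¬ TightCrossing k G e →
  (W : VSet G) → k ≤ d G W → k ≤ d (delete G e) W
cut-survives-delete {k} G e noTight W k≤dW with crosses G W e in crossing | d-delete G e W
... | false | dW≡ = subst (k ≤_) dW≡ k≤dW
... | true  | dW≡ = s≤s⁻¹ (subst (k <_) dW≡ (≤∧≢⇒< k≤dW (λ k≡dW → noTight (W , sym k≡dW , crossing))))

delete-preserves-EdgeConn : ∀ {k} (G : Graph) (e : Fin (m G)) → ¬ TightCrossing k G e →
  EdgeConn k G → EdgeConn k (delete G e)
delete-preserves-EdgeConn G e noTight conn W nonempty proper =
  cut-survives-delete G e noTight W (conn W nonempty proper)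

delete-preserves-NearlyWith : ∀ {k} (G : Graph) (e : Fin (m G)) (u : Fin (n G)) →
  ¬ TightCrossing k G e → proj₁ (ends G e) ≢ u → proj₂ (ends G e) ≢ u →
  NearlyWith k G u → NearlyWith k (delete G e) u
delete-preserves-NearlyWith {k} G e u noTight end₁≢u end₂≢u (even , small , large) =
  subst Even degᵤ≡ even , subst (_< k) degᵤ≡ small ,
  λ W nonempty proper ≠single ≠cosingle →
    cut-survives-delete G e noTight W (large W nonempty proper ≠single ≠cosingle)
  where
  degᵤ≡ : deg G u ≡ deg (delete G e) u
  degᵤ≡ = sym (deg-delete G e u end₁≢u end₂≢u)

LargeAwayFrom : ℕ → (G : Graph) → Fin (n G) → Set
LargeAwayFrom k G u = (Y : VSet G) → Nonempty G Y → Proper G Y →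
  ¬ (_≐_ {G} Y (single G u)) → ¬ (_≐_ {G} Y (compl G (single G u))) → k ≤ d G Y

EdgeConn⇒LargeAwayFrom : ∀ {k} (G : Graph) (u : Fin (n G)) → EdgeConn k G → LargeAwayFrom k G u
EdgeConn⇒LargeAwayFrom G u conn Y nonempty proper _ _ = conn Y nonempty proper

special-is-light : ∀ {k} (G : Graph) (u v : Fin (n G)) → NearlyWith k G u → k < deg G v → v ≢ u
special-is-light G u .u (_ , degᵤ<k , _) k<degᵤ refl = 1+n≰n (<-≤-trans k<degᵤ (<⇒≤ degᵤ<k))

module _ (G : Graph) {u : Fin (n G)} (Y : VSet G) where

  ≉single-by-member : ∀ {v} → Y v ≡ true → v ≢ u → ¬ (_≐_ {G} Y (single G u))
  ≉single-by-member {v} Yv v≢u Y≐ = true≢false (trans (sym Yv) (trans (Y≐ v) (≟-false v≢u)))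

  ≉single-by-u : Y u ≡ false → ¬ (_≐_ {G} Y (single G u))
  ≉single-by-u Yu Y≐ = true≢false (trans (sym (≟-refl u)) (trans (sym (Y≐ u)) Yu))

  ≉cosingle-by-nonmember : ∀ {v} → Y v ≡ false → v ≢ u → ¬ (_≐_ {G} Y (compl G (single G u)))
  ≉cosingle-by-nonmember {v} Yv v≢u Y≐ =
    true≢false (trans (sym (cong not (≟-false v≢u))) (trans (sym (Y≐ v)) Yv))

  ≉cosingle-by-u : Y u ≡ true → ¬ (_≐_ {G} Y (compl G (single G u)))
  ≉cosingle-by-u Yu Y≐ = true≢false (trans (sym Yu) (trans (Y≐ u) (cong not (≟-refl u))))

module Uncrossing {k : ℕ} (G : Graph) (u : Fin (n G)) (large : LargeAwayFrom k G u) where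

  Tight : VSet G → Set
  Tight A = d G A ≡ k

  TightPart : VSet G → Set
  TightPart Z = Σ (VSet G) λ Z' → Tight Z' × Z' ⊆ Z × count Z' < count Z

  squeeze : ∀ {a b} → a + b ≤ k + k → k ≤ a → k ≤ b → a ≡ k
  squeeze {a} a+b≤2k k≤a k≤b =
    ≤-antisym (+-cancelʳ-≤ k a k (≤-trans (+-monoʳ-≤ a k≤b) a+b≤2k)) k≤a

  module _ {Z W : VSet G} (tightZ : Tight Z) (tightW : Tight W) (Zu : Z u ≡ false)
           {p q : Fin (n G)} (Zp : Z p ≡ true) (Zq : Z q ≡ true) (Wp : W p ≡ true) (Wq : W q ≡ false)
           where

    member-≢u : ∀ {v} → Z v ≡ true → v ≢ u
    member-≢u Zv refl = true≢false (trans (sym Zv) Zu)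

    -- If W ⊆ Z, W itself (it misses q).
    W-part : W ⊆ Z → TightPart Z
    W-part W⊆Z = W , tightW , W⊆Z , count-⊂ W⊆Z q Wq Zq

    -- If r ∈ W ∖ Z and u ∉ W, neither Z ∖ W nor W ∖ Z is {u} or V ∖ {u}.
    difference-part : ∀ {r} → W r ≡ true → Z r ≡ false → W u ≡ false → TightPart Z
    difference-part {r} Wr Zr Wu = Z ∖ W , tight , ∩-⊆ˡ Z (∁ W) , count-⊂ (∩-⊆ˡ Z (∁ W)) p (∉∖ʳ Z W Wp) Zp
      where
      large-Z∖W : k ≤ d G (Z ∖ W)
      large-Z∖W = large (Z ∖ W) (q , ∈∖ Z W Zq Wq) (p , ∉∖ʳ Z W Wp)
        (≉single-by-member G (Z ∖ W) (∈∖ Z W Zq Wq) (member-≢u Zq))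
        (≉cosingle-by-nonmember G (Z ∖ W) (∉∖ʳ Z W Wp) (member-≢u Zp))
      large-W∖Z : k ≤ d G (W ∖ Z)
      large-W∖Z = large (W ∖ Z) (r , ∈∖ W Z Wr Zr) (p , ∉∖ʳ W Z Zp)
        (≉single-by-u G (W ∖ Z) (∉∖ˡ W Z Wu))
        (≉cosingle-by-nonmember G (W ∖ Z) (∉∖ʳ W Z Zp) (member-≢u Zp))
      tight : Tight (Z ∖ W)
      tight = squeeze (subst₂ (λ a b → _ ≤ a + b) tightZ tightW (posimodular G Z W)) large-Z∖W large-W∖Z

    -- If V ∖ W ⊆ Z, V ∖ W, tight as δ(V ∖ W) = δ(W) (it misses p).
    complement-part : ∁ W ⊆ Z → TightPart Z
    complement-part ∁W⊆Z = ∁ W , trans (d-∁ G W) tightW , ∁W⊆Z , count-⊂ ∁W⊆Z p (cong not Wp) Zp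

    -- If s ∉ Z ∪ W and u ∈ W, neither Z ∩ W nor Z ∪ W is {u} or V ∖ {u}.
    intersection-part : ∀ {s} → Z s ≡ false → W s ≡ false → W u ≡ true → TightPart Z
    intersection-part {s} Zs Ws Wu = Z ∩ W , tight , ∩-⊆ˡ Z W , count-⊂ (∩-⊆ˡ Z W) q (∉∩ʳ Z W Wq) Zq
      where
      large-Z∩W : k ≤ d G (Z ∩ W)
      large-Z∩W = large (Z ∩ W) (p , ∈∩ Z W Zp Wp) (q , ∉∩ʳ Z W Wq)
        (≉single-by-member G (Z ∩ W) (∈∩ Z W Zp Wp) (member-≢u Zp))
        (≉cosingle-by-nonmember G (Z ∩ W) (∉∩ʳ Z W Wq) (member-≢u Zq))
      large-Z∪W : k ≤ d G (Z ∪ W)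
      large-Z∪W = large (Z ∪ W) (p , ∈∪ˡ Z W Zp) (s , ∉∪ Z W Zs Ws)
        (≉single-by-member G (Z ∪ W) (∈∪ˡ Z W Zp) (member-≢u Zp))
        (≉cosingle-by-u G (Z ∪ W) (∈∪ʳ Z W Wu))
      tight : Tight (Z ∩ W)
      tight = squeeze (subst₂ (λ a b → _ ≤ a + b) tightZ tightW (submodular G Z W)) large-Z∩W large-Z∪W

    tight-part : TightPart Z
    tight-part with ⊆-or-escape W Z
    ... | inj₁ W⊆Z = W-part W⊆Z
    ... | inj₂ (r , Wr , Zr) with W u in Wu
    ...   | false = difference-part Wr Zr Wu
    ...   | true with ⊆-or-escape (∁ W) Z
    ...     | inj₁ ∁W⊆Z = complement-part ∁W⊆Z
    ...     | inj₂ (s , ∁Ws , Zs) = intersection-part Zs (not-true ∁Ws) Wu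

module Descent {k : ℕ} (k≥1 : 1 ≤ k) (G : Graph) (u : Fin (n G)) (large : LargeAwayFrom k G u)
               (X : VSet G) (Xu : X u ≡ false) (heavy : ∀ x → X x ≡ true → k < deg G x) where

  open Uncrossing G u large

  -- A tight set of heavy vertices contains an edge, since otherwise the
  -- degree of any of its vertices would be at most its cut.
  inner-edge : (Z : VSet G) → Tight Z → Z ⊆ X → ∃ (Inside G Z)
  inner-edge Z tightZ Z⊆X
    with any? (λ e → (Z (proj₁ (ends G e)) ≟ᵇ true) ×-dec (Z (proj₂ (ends G e)) ≟ᵇ true))
  ... | yes edge = edge
  ... | no noEdge with positive-cut-nonempty G Z (subst (1 ≤_) (sym tightZ) k≥1)
  ...   | x , Zx = ⊥-elim (<-irrefl refl (<-≤-trans (heavy x (Z⊆X x Zx)) degₓ≤k))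
    where
    degₓ≤k : deg G x ≤ k
    degₓ≤k = subst (deg G x ≤_) tightZ (deg≤cut G Z x Zx (λ e inside → noEdge (e , inside)))

  tight-crossing? : (e : Fin (m G)) → Dec (TightCrossing k G e)
  tight-crossing? e
    with anySubset? (λ S → (d G (lookup S) ≟ k) ×-dec (crosses G (lookup S) e ≟ᵇ true))
  ... | yes (S , tight , crossing) = yes (lookup S , tight , crossing)
  ... | no none = no λ (W , tight , crossing) →
    none (tabulate W , trans (d-cong G (lookup∘tabulate W)) tight ,
          trans (cong₂ _xor_ (lookup∘tabulate W _) (lookup∘tabulate W _)) crossing)

  descend : (Z : VSet G) → Acc _<_ (count Z) → Tight Z → Z ⊆ X →
    ∃ λ e → Inside G Z e × ¬ TightCrossing k G e
  descend Z (acc smaller) tightZ Z⊆X with inner-edge Z tightZ Z⊆X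
  ... | e , Ze₁ , Ze₂ with tight-crossing? e
  ...   | no noTight = e , (Ze₁ , Ze₂) , noTight
  ...   | yes (W , tightW , crossing) = descend-into (separated (xor-true _ _ crossing))
    where
    Zu : Z u ≡ false
    Zu = ⊆-∉ Z⊆X Xu
    separated : (W (proj₁ (ends G e)) ≡ true × W (proj₂ (ends G e)) ≡ false) ⊎
                (W (proj₁ (ends G e)) ≡ false × W (proj₂ (ends G e)) ≡ true) → TightPart Z
    separated (inj₁ (We₁ , We₂)) = tight-part {Z = Z} {W = W} tightZ tightW Zu Ze₁ Ze₂ We₁ We₂
    separated (inj₂ (We₁ , We₂)) = tight-part {Z = Z} {W = W} tightZ tightW Zu Ze₂ Ze₁ We₂ We₁
    descend-into : TightPart Z → ∃ λ e → Inside G Z e × ¬ TightCrossing k G e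
    descend-into (Z' , tightZ' , Z'⊆Z , fewer)
      with descend Z' (smaller fewer) tightZ' (λ v Z'v → Z⊆X v (Z'⊆Z v Z'v))
    ... | e' , (Z'e₁ , Z'e₂) , noTight = e' , (Z'⊆Z _ Z'e₁ , Z'⊆Z _ Z'e₂) , noTight

  uncrossed-edge : Tight X → ∃ λ e → Inside G X e × ¬ TightCrossing k G e
  uncrossed-edge tightX = descend X (<-wellFounded (count X)) tightX (λ _ Xv → Xv)

-- In a nearly k-edge-connected graph, a set X with d(X) ≥ 1 whose vertices
-- have degree above k avoids some vertex u at which the cut condition
-- holds: the special vertex if there is one, any vertex outside X otherwise.
anchor-outside : ∀ {k} (G : Graph) (X : VSet G) → NearlyEdgeConn k G → 1 ≤ d G X →
  (∀ x → X x ≡ true → k < deg G x) → ∃ λ u → X u ≡ false × LargeAwayFrom k G u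
anchor-outside G X (inj₁ conn) dX≥1 heavy with positive-cut-proper G X dX≥1
... | u , Xu = u , Xu , EdgeConn⇒LargeAwayFrom G u conn
anchor-outside G X (inj₂ (u , special)) dX≥1 heavy =
  u , ¬-not (λ Xu → special-is-light G u u special (heavy u Xu) refl) , proj₂ (proj₂ special)

-- The theorem: the special vertex (if any) lies outside X, so the edge
-- found by the descent inside X avoids it.
mainTheorem2 : (k : ℕ) → Even k → 1 ≤ k → (G : Graph) → NearlyEdgeConn k G →
    (X : VSet G) → d G X ≡ k → ((x : Fin (n G)) → X x ≡ true → deg G x ≡ suc k) →
    Σ (Fin (m G)) λ e →
      (X (proj₁ (ends G e)) ≡ true × X (proj₂ (ends G e)) ≡ true) ×
      (EdgeConn k G → EdgeConn k (delete G e)) ×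
      ((u : Fin (n G)) → NearlyWith k G u → NearlyWith k (delete G e) u)
mainTheorem2 k _ k≥1 G nearly X dX≡k degX =
  let (e , (Xe₁ , Xe₂) , noTight) = uncrossed-edge-in-X
  in e , (Xe₁ , Xe₂) , delete-preserves-EdgeConn G e noTight ,
     λ u special → delete-preserves-NearlyWith G e u noTight
       (special-is-light G u _ special (heavy _ Xe₁)) (special-is-light G u _ special (heavy _ Xe₂))
       special
  where
  heavy : ∀ x → X x ≡ true → k < deg G x
  heavy x Xx = ≤-reflexive (sym (degX x Xx))
  uncrossed-edge-in-X : ∃ λ e → Inside G X e × ¬ TightCrossing k G e
  uncrossed-edge-in-X with anchor-outside G X nearly (subst (1 ≤_) (sym dX≡k) k≥1) heavy
  ... | u , Xu , large = Descent.uncrossed-edge k≥1 G u large X Xu heavy dX≡k
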